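{- Let $\mathcal R$ and $\mathcal S$ be term rewrite systems, let $\mathcal A$ be a strongly linear interpretation compatible with $\mathcal S$, and let $\mathcal R$ be non-duplicating. Then for every term $t$ that is terminating with respect to $\to_{\mathcal R\cup\mathcal S}$, $$\mathrm{dh}(t,\to_{\mathcal R\cup\mathcal S})\le(1+\mathrm{WG}(\mathcal A,\mathcal R))\cdot\mathrm{dh}(t,\to_{\mathcal R/\mathcal S})+\mathsf M_{\mathcal A}\cdot|t|.$$
   Context: $\mathrm{dh}(s,\to)=\max\{n\mid\exists u:\ s\to^n u\}$; $|t|$ is the number of symbols of $t$. A TRS is non-duplicating if no variable occurs more often in a right-hand side than in the corresponding left-hand side. The relative rewrite relation is $\to_{\mathcal R/\mathcal S}=\to_{\mathcal S}^*\cdot\to_{\mathcal R}\cdot\to_{\mathcal S}^*$. A strongly linear interpretation (SLI) $\mathcal A$ interprets every $n$-ary function symbol $f$ over $\mathbb N$ by $f_{\mathcal A}(x_1,\dots,x_n)=x_1+\dots+x_n+c_f$ with $c_f\in\mathbb N$; $\mathcal A$ is compatible with $\mathcal S$ if for every rule $l\to r\in\mathcal S$ and every assignment $\alpha:\mathcal V\to\mathbb N$ the value of $l$ exceeds that of $r$ (with respect to the standard order on $\mathbb N$). $[t]$ denotes the value of $t$ under the assignment mapping every variable to $0$; $\mathsf M_{\mathcal A}=\max\{f_{\mathcal A}(0,\dots,0)\mid f\in\mathcal F\}$; the weight gap is $\mathrm{WG}(\mathcal A,\mathcal R)=\max\{[r]\dot-[l]\mid l\to r\in\mathcal R\}$ with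 $m\dot- n=\max\{m-n,0\}$. -}

module Defs where

open import Data.Nat using (ℕ; zero; suc; _+_; _*_; _∸_; _⊔_; _≤_; _<_)
open import Data.Fin using (Fin)
open import Data.Vec using (Vec; []; _∷_; lookup; _[_]≔_)
open import Data.List using (List; []; _∷_; _++_)
open import Data.List.Membership.Propositional using (_∈_)
open import Data.Product using (_×_; _,_; ∃; Σ)
open import Relation.Binary.Construct.Closure.ReflexiveTransitive using (Star)
open import Induction.WellFounded using (Acc)
open import Relation.Nullary using (¬_)
open import Relation.Binary.PropositionalEquality using (_≡_)

module _ {k : ℕ} (ar : Fin k → ℕ) where

  data Term : Set where
    var : ℕ → Term
    fun : (f : Fin k) → Vec Term (ar f) → Term

  Rule : Set
  Rule = Term × Term

  mutual
    subst : (ℕ → Term) → Term → Term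
    subst σ (var x)    = σ x
    subst σ (fun f ts) = fun f (substs σ ts)

    substs : ∀ {n} → (ℕ → Term) → Vec Term n → Vec Term n
    substs σ []       = []
    substs σ (t ∷ ts) = subst σ t ∷ substs σ ts

  mutual
    count : ℕ → Term → ℕ
    count x (var y) with x Data.Nat.≟ y
    ... | Relation.Nullary.yes _ = 1
    ... | Relation.Nullary.no  _ = 0
    count x (fun f ts) = counts x ts

    counts : ∀ {n} → ℕ → Vec Term n → ℕ
    counts x []       = 0
    counts x (t ∷ ts) = count x t + counts x ts

  mutual
    size : Term → ℕ
    size (var x)    = 1
    size (fun f ts) = suc (sizes ts)

    sizes : ∀ {n} → Vec Term n → ℕ
    sizes []       = 0
    sizes (t ∷ ts) = size t + sizes ts

  IsVar : Term → Set
  IsVar t = Σ ℕ (λ x → t ≡ var x)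

  IsTRS : List Rule → Set
  IsTRS R = ∀ {l r} → (l , r) ∈ R →
    (¬ IsVar l) × (∀ x → 0 < count x r → 0 < count x l)

  NonDuplicating : List Rule → Set
  NonDuplicating R = ∀ {l r} → (l , r) ∈ R → ∀ x → count x r ≤ count x l

  data Step (R : List Rule) : Term → Term → Set where
    root : ∀ {l r} (σ : ℕ → Term) → (l , r) ∈ R → Step R (subst σ l) (subst σ r)
    ctx  : ∀ (f : Fin k) (ts : Vec Term (ar f)) (i : Fin (ar f)) {u} →
           Step R (lookup ts i) u → Step R (fun f ts) (fun f (ts [ i ]≔ u))

  RelStep : List Rule → List Rule → Term → Term → Set
  RelStep R S s t = ∃ λ s' → ∃ λ t' →
    Star (Step S) s s' × Step R s' t' × Star (Step S) t' t

  data Iter (_⟶_ : Term → Term → Set) : ℕ → Term → Term → Set where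
    done : ∀ {s} → Iter _⟶_ zero s s
    step : ∀ {n s t u} → s ⟶ t → Iter _⟶_ n t u → Iter _⟶_ (suc n) s u

  IsDh : (Term → Term → Set) → Term → ℕ → Set
  IsDh _⟶_ s n = (∃ λ u → Iter _⟶_ n s u) × (∀ m u → Iter _⟶_ m s u → m ≤ n)

  Terminating : (Term → Term → Set) → Term → Set
  Terminating _⟶_ s = Acc (λ u t → t ⟶ u) s

  -- Strongly linear interpretation: f_A(x1..xn) = x1 + ... + xn + c f
  mutual
    eval : (c : Fin k → ℕ) → (ℕ → ℕ) → Term → ℕ
    eval c α (var x)    = α x
    eval c α (fun f ts) = evals c α ts + c f

    evals : ∀ {n} → (c : Fin k → ℕ) → (ℕ → ℕ) → Vec Term n → ℕ
    evals c α []       = 0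
    evals c α (t ∷ ts) = eval c α t + evals c α ts

  val0 : (Fin k → ℕ) → Term → ℕ
  val0 c t = eval c (λ _ → 0) t

  Compatible : (Fin k → ℕ) → List Rule → Set
  Compatible c S = ∀ {l r} → (l , r) ∈ S → ∀ (α : ℕ → ℕ) → eval c α r < eval c α l

  WG : (Fin k → ℕ) → List Rule → ℕ
  WG c []            = 0
  WG c ((l , r) ∷ R) = (val0 c r ∸ val0 c l) ⊔ WG c R

maxFin : ∀ {k} → (Fin k → ℕ) → ℕ
maxFin {zero}  g = 0
maxFin {suc k} g = g Data.Fin.zero ⊔ maxFin (λ i → g (Data.Fin.suc i))

-- M_A = max { f_A(0,...,0) | f ∈ F } = max { c f | f ∈ F }
MA : ∀ {k} → (Fin k → ℕ) → ℕ
MA c = maxFin c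

module Submission where

-- Write [t] for the value of t under the zero assignment.
-- Every (R ∪ S)-step s → t moves the potential [·] in a controlled way:
--   * an S-step strictly decreases it ([t] + 1 ≤ [s]), by compatibility;
--   * an R-step raises it by at most WG ([t] ≤ [s] + WG), because R is
--     non-duplicating: an SLI is affine, eval α u = [u] + Σₓ count x u · α x,
--     so a rule whose right side has no more variable occurrences than its
--     left side can only gain the constant part [r] ∸ [l].
-- Both facts hold for root steps by the substitution lemma and lift through
-- contexts since SLIs are additive in the arguments.  Hence along any
-- derivation of length n containing m R-steps, n ≤ (1 + WG) · m + [s]; the
-- m R-steps group into an R/S-derivation of length m ≤ dh(t, →R/S), and
-- [t] ≤ M_A · |t| as each symbol contributes at most M_A.

open import Defs
open import Data.Nat using (ℕ; _+_; _*_; _≤_)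
open import Data.Fin using (Fin)
open import Data.List using (List; _++_)

open import Data.Nat using (zero; suc; _∸_; _⊔_; _<_; z≤n; s≤s; _≟_)
open import Data.Nat.Properties
open import Data.Nat.Tactic.RingSolver using (solve-∀)
open import Data.Fin as Fin using ()
open import Data.Vec using (Vec; []; _∷_; lookup; _[_]≔_)
open import Data.List using (_∷_)
open import Data.List.Relation.Unary.Any using (here; there)
open import Data.List.Membership.Propositional using (_∈_)
open import Data.List.Membership.Propositional.Properties using (∈-++⁻)
open import Data.Product using (_×_; _,_; ∃; Σ)
open import Data.Sum using (_⊎_; inj₁; inj₂)
open import Data.Empty using (⊥-elim)
open import Relation.Nullary using (yes; no)
open import Relation.Binary.Construct.Closure.ReflexiveTransitive using (ε; _◅_)
open import Relation.Binary.PropositionalEquality as P using (_≡_; _≢_; refl; sym; trans; cong; cong₂; module ≡-Reasoning)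

sumTo : ℕ → (ℕ → ℕ) → ℕ
sumTo zero    g = 0
sumTo (suc n) g = sumTo n g + g n

+-interchange : ∀ a b c d → (a + b) + (c + d) ≡ (a + c) + (b + d)
+-interchange = solve-∀

sumTo-+ : ∀ N f g → sumTo N (λ x → f x + g x) ≡ sumTo N f + sumTo N g
sumTo-+ zero    f g = refl
sumTo-+ (suc N) f g rewrite sumTo-+ N f g = +-interchange (sumTo N f) (sumTo N g) (f N) (g N)

sumTo-cong : ∀ N {f g} → (∀ x → f x ≡ g x) → sumTo N f ≡ sumTo N g
sumTo-cong zero    eq = refl
sumTo-cong (suc N) eq = cong₂ _+_ (sumTo-cong N eq) (eq N)

sumTo-mono : ∀ N {f g} → (∀ x → f x ≤ g x) → sumTo N f ≤ sumTo N g
sumTo-mono zero    le = z≤n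
sumTo-mono (suc N) le = +-mono-≤ (sumTo-mono N le) (le N)

sumTo-zero : ∀ N → sumTo N (λ _ → 0) ≡ 0
sumTo-zero zero    = refl
sumTo-zero (suc N) = trans (+-identityʳ _) (sumTo-zero N)

sumTo-below-support : ∀ {g y} → (∀ x → x ≢ y → g x ≡ 0) → ∀ N → N ≤ y → sumTo N g ≡ 0
sumTo-below-support vanish zero    _    = refl
sumTo-below-support vanish (suc N) N<y
  rewrite sumTo-below-support vanish N (<⇒≤ N<y) | vanish N (λ N≡y → <⇒≢ N<y N≡y) = refl

sumTo-point : ∀ {g y} → (∀ x → x ≢ y → g x ≡ 0) → ∀ N → y < N → sumTo N g ≡ g y
sumTo-point {g} {y} vanish (suc N) y<1+N with N ≟ y
... | yes refl = cong (_+ g N) (sumTo-below-support vanish N ≤-refl)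
... | no  N≢y  rewrite sumTo-point vanish N (≤∧≢⇒< (≤-pred y<1+N) (λ y≡N → N≢y (sym y≡N)))
                     | vanish N N≢y = +-identityʳ (g y)

maxFin-upper : ∀ {k} (g : Fin k → ℕ) (i : Fin k) → g i ≤ maxFin g
maxFin-upper g Fin.zero    = m≤m⊔n _ _
maxFin-upper g (Fin.suc i) = ≤-trans (maxFin-upper (λ j → g (Fin.suc j)) i) (m≤n⊔m _ _)

-- Budget arithmetic: an R-step pays 1 + WG from a new R/S-step, and an
-- S-step pays 1 from the decrease of the potential.
R-step-budget : ∀ w m n p q → n ≤ suc w * m + p → p + 0 ≤ q + w → suc n ≤ suc w * suc m + q
R-step-budget w m n p q n≤ p≤ = begin
  suc n                      ≤⟨ s≤s n≤ ⟩
  suc (suc w * m + p)        ≤⟨ s≤s (+-monoʳ-≤ (suc w * m) (≤-trans (≤-reflexive (sym (+-identityʳ p))) p≤)) ⟩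
  suc (suc w * m + (q + w))  ≡⟨ rearrange w m q ⟩
  suc w * suc m + q          ∎
  where
  open ≤-Reasoning
  rearrange : ∀ w m q → suc (suc w * m + (q + w)) ≡ suc w * suc m + q
  rearrange = solve-∀

S-step-budget : ∀ w m n p q → n ≤ suc w * m + p → p + 1 ≤ q + 0 → suc n ≤ suc w * m + q
S-step-budget w m n p q n≤ p< = begin
  suc n                ≤⟨ s≤s n≤ ⟩
  suc (suc w * m + p)  ≡⟨ sym (+-suc (suc w * m) p) ⟩
  suc w * m + suc p    ≡⟨ cong (suc w * m +_) (+-comm 1 p) ⟩
  suc w * m + (p + 1)  ≤⟨ +-monoʳ-≤ (suc w * m) (≤-trans p< (≤-reflexive (+-identityʳ q))) ⟩
  suc w * m + q        ∎
  where open ≤-Reasoning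

module _ {k : ℕ} (ar : Fin k → ℕ) where

  mutual
    varBound : Term ar → ℕ
    varBound (var y)    = suc y
    varBound (fun f ts) = varBounds ts

    varBounds : ∀ {n} → Vec (Term ar) n → ℕ
    varBounds []       = 0
    varBounds (t ∷ ts) = varBound t ⊔ varBounds ts

  count-var-self : ∀ y → count ar y (var y) ≡ 1
  count-var-self y with y ≟ y
  ... | yes _ = refl
  ... | no  y≢y = ⊥-elim (y≢y refl)

  count-var-other : ∀ {x y} → x ≢ y → count ar x (var y) ≡ 0
  count-var-other {x} {y} x≢y with x ≟ y
  ... | yes x≡y = ⊥-elim (x≢y x≡y)
  ... | no  _   = refl

  weight : (ℕ → ℕ) → Term ar → ℕ
  weight α t = eval ar (λ _ → 0) α t

  weights : ∀ {n} → (ℕ → ℕ) → Vec (Term ar) n → ℕ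
  weights α ts = evals ar (λ _ → 0) α ts

  mutual
    weight-as-sum : ∀ α t N → varBound t ≤ N →
      weight α t ≡ sumTo N (λ x → count ar x t * α x)
    weight-as-sum α (var y) N y<N = sym (begin
      sumTo N (λ x → count ar x (var y) * α x)  ≡⟨ sumTo-point vanish N y<N ⟩
      count ar y (var y) * α y                  ≡⟨ cong (_* α y) (count-var-self y) ⟩
      1 * α y                                   ≡⟨ *-identityˡ (α y) ⟩
      α y                                       ∎)
      where
      open ≡-Reasoning
      vanish : ∀ x → x ≢ y → count ar x (var y) * α x ≡ 0
      vanish x x≢y rewrite count-var-other x≢y = refl
    weight-as-sum α (fun f ts) N le = trans (+-identityʳ _) (weights-as-sum α ts N le)

    weights-as-sum : ∀ {n} α (ts : Vec (Term ar) n) N → varBounds ts ≤ N →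
      weights α ts ≡ sumTo N (λ x → counts ar x ts * α x)
    weights-as-sum α []       N _  = sym (sumTo-zero N)
    weights-as-sum α (t ∷ ts) N le = begin
      weight α t + weights α ts
        ≡⟨ cong₂ _+_ (weight-as-sum α t N (≤-trans (m≤m⊔n _ _) le))
                     (weights-as-sum α ts N (≤-trans (m≤n⊔m _ _) le)) ⟩
      sumTo N (λ x → count ar x t * α x) + sumTo N (λ x → counts ar x ts * α x)
        ≡⟨ sym (sumTo-+ N _ _) ⟩
      sumTo N (λ x → count ar x t * α x + counts ar x ts * α x)
        ≡⟨ sumTo-cong N (λ x → sym (*-distribʳ-+ (α x) (count ar x t) (counts ar x ts))) ⟩
      sumTo N (λ x → (count ar x t + counts ar x ts) * α x) ∎
      where open ≡-Reasoning

  weight-mono : ∀ α {l r} → (∀ x → count ar x r ≤ count ar x l) → weight α r ≤ weight α l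
  weight-mono α {l} {r} fewer = begin
    weight α r                              ≡⟨ weight-as-sum α r N (m≤n⊔m _ _) ⟩
    sumTo N (λ x → count ar x r * α x)      ≤⟨ sumTo-mono N (λ x → *-monoˡ-≤ (α x) (fewer x)) ⟩
    sumTo N (λ x → count ar x l * α x)      ≡⟨ sym (weight-as-sum α l N (m≤m⊔n _ _)) ⟩
    weight α l                              ∎
    where
    open ≤-Reasoning
    N = varBound l ⊔ varBound r

  split-step : ∀ R S {s t} → Step ar (R ++ S) s t → Step ar R s t ⊎ Step ar S s t
  split-step R S (root σ l→r) with ∈-++⁻ R l→r
  ... | inj₁ inR = inj₁ (root σ inR)
  ... | inj₂ inS = inj₂ (root σ inS)
  split-step R S (ctx f ts i s→u) with split-step R S s→u
  ... | inj₁ R-step = inj₁ (ctx f ts i R-step)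
  ... | inj₂ S-step = inj₂ (ctx f ts i S-step)

  RelDerivation : List (Rule ar) → List (Rule ar) → ℕ → Term ar → Set
  RelDerivation R S m s = ∃ λ u → Iter ar (RelStep ar R S) m s u

  prepend-S-step : ∀ {R S m s t} → Step ar S s t → RelDerivation R S m t → RelDerivation R S m s
  prepend-S-step {s = s} s→t (_ , done) = s , done
  prepend-S-step s→t (u , step (s′ , t′ , s→*s′ , R-step , t′→*t) rest) =
    u , step (s′ , t′ , s→t ◅ s→*s′ , R-step , t′→*t) rest

  module _ (c : Fin k → ℕ) where

    mutual
      eval-affine : ∀ α t → eval ar c α t ≡ val0 ar c t + weight α t
      eval-affine α (var x)    = refl
      eval-affine α (fun f ts) rewrite evals-affine α ts =
        rearrange (evals ar c (λ _ → 0) ts) (weights α ts) (c f)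
        where
        rearrange : ∀ a w d → (a + w) + d ≡ (a + d) + (w + 0)
        rearrange = solve-∀

      evals-affine : ∀ {n} α (ts : Vec (Term ar) n) →
        evals ar c α ts ≡ evals ar c (λ _ → 0) ts + weights α ts
      evals-affine α []       = refl
      evals-affine α (t ∷ ts) rewrite eval-affine α t | evals-affine α ts =
        +-interchange (val0 ar c t) (weight α t) (evals ar c (λ _ → 0) ts) (weights α ts)

    nonDuplicating-gain : ∀ α {l r} → (∀ x → count ar x r ≤ count ar x l) →
      eval ar c α r ≤ eval ar c α l + (val0 ar c r ∸ val0 ar c l)
    nonDuplicating-gain α {l} {r} fewer = begin
      eval ar c α r                              ≡⟨ eval-affine α r ⟩
      val0 ar c r + weight α r                   ≤⟨ +-mono-≤ (m≤n+m∸n (val0 ar c r) (val0 ar c l))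
                                                             (weight-mono α {l} {r} fewer) ⟩
      (val0 ar c l + gain) + weight α l          ≡⟨ rearrange (val0 ar c l) gain (weight α l) ⟩
      (val0 ar c l + weight α l) + gain          ≡⟨ cong (_+ gain) (sym (eval-affine α l)) ⟩
      eval ar c α l + gain                       ∎
      where
      open ≤-Reasoning
      gain = val0 ar c r ∸ val0 ar c l
      rearrange : ∀ a g w → (a + g) + w ≡ (a + w) + g
      rearrange = solve-∀

    mutual
      eval-subst : ∀ α σ t → eval ar c α (subst ar σ t) ≡ eval ar c (λ x → eval ar c α (σ x)) t
      eval-subst α σ (var x)    = refl
      eval-subst α σ (fun f ts) = cong (_+ c f) (evals-subst α σ ts)

      evals-subst : ∀ {n} α σ (ts : Vec (Term ar) n) →
        evals ar c α (substs ar σ ts) ≡ evals ar c (λ x → eval ar c α (σ x)) ts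
      evals-subst α σ []       = refl
      evals-subst α σ (t ∷ ts) = cong₂ _+_ (eval-subst α σ t) (evals-subst α σ ts)

    evals-update : ∀ α {n} (ts : Vec (Term ar) n) i u →
      evals ar c α (ts [ i ]≔ u) + eval ar c α (lookup ts i) ≡ evals ar c α ts + eval ar c α u
    evals-update α (t ∷ ts) Fin.zero    u = swap (eval ar c α u) (evals ar c α ts) (eval ar c α t)
      where
      swap : ∀ u e t → (u + e) + t ≡ (t + e) + u
      swap = solve-∀
    evals-update α (t ∷ ts) (Fin.suc i) u = begin
      (eval ar c α t + evals ar c α (ts [ i ]≔ u)) + eval ar c α (lookup ts i)
        ≡⟨ +-assoc (eval ar c α t) _ _ ⟩
      eval ar c α t + (evals ar c α (ts [ i ]≔ u) + eval ar c α (lookup ts i))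
        ≡⟨ cong (eval ar c α t +_) (evals-update α ts i u) ⟩
      eval ar c α t + (evals ar c α ts + eval ar c α u)
        ≡⟨ sym (+-assoc (eval ar c α t) _ _) ⟩
      (eval ar c α t + evals ar c α ts) + eval ar c α u ∎
      where open ≡-Reasoning

    context-bound : ∀ α a b f (ts : Vec (Term ar) (ar f)) i u →
      eval ar c α u + a ≤ eval ar c α (lookup ts i) + b →
      eval ar c α (fun f (ts [ i ]≔ u)) + a ≤ eval ar c α (fun f ts) + b
    context-bound α a b f ts i u hole = +-cancelʳ-≤ L _ _ (begin
      ((E′ + c f) + a) + L  ≡⟨ regroup E′ L (c f) a ⟩
      (E′ + L) + (c f + a)  ≡⟨ cong (_+ (c f + a)) (evals-update α ts i u) ⟩
      (E + U) + (c f + a)   ≡⟨ regroup′ E U (c f) a ⟩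
      (E + c f) + (U + a)   ≤⟨ +-monoʳ-≤ (E + c f) hole ⟩
      (E + c f) + (L + b)   ≡⟨ regroup″ (E + c f) L b ⟩
      ((E + c f) + b) + L   ∎)
      where
      open ≤-Reasoning
      E′ = evals ar c α (ts [ i ]≔ u)
      E  = evals ar c α ts
      L  = eval ar c α (lookup ts i)
      U  = eval ar c α u
      regroup : ∀ e l d a → ((e + d) + a) + l ≡ (e + l) + (d + a)
      regroup = solve-∀
      regroup′ : ∀ e u d a → (e + u) + (d + a) ≡ (e + d) + (u + a)
      regroup′ = solve-∀
      regroup″ : ∀ e l b → e + (l + b) ≡ (e + b) + l
      regroup″ = solve-∀

    step-bound : ∀ {T : List (Rule ar)} a b →
      (∀ {l r} → (l , r) ∈ T → ∀ α → eval ar c α r + a ≤ eval ar c α l + b) →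
      ∀ α {s t} → Step ar T s t → eval ar c α t + a ≤ eval ar c α s + b
    step-bound a b rules α (root {l} {r} σ l→r)
      rewrite eval-subst α σ l | eval-subst α σ r = rules l→r _
    step-bound a b rules α (ctx f ts i {u} s→u) =
      context-bound α a b f ts i u (step-bound a b rules α s→u)

    S-step-decreases : ∀ {S} → Compatible ar c S →
      ∀ α {s t} → Step ar S s t → eval ar c α t + 1 ≤ eval ar c α s + 0
    S-step-decreases compatible = step-bound 1 0 λ l→r α →
      P.subst₂ _≤_ (+-comm 1 _) (sym (+-identityʳ _)) (compatible l→r α)

    WG-upper : ∀ R {l r} → (l , r) ∈ R → val0 ar c r ∸ val0 ar c l ≤ WG ar c R
    WG-upper ((l , r) ∷ R) (here refl) = m≤m⊔n _ _
    WG-upper (_ ∷ R)       (there l→r) = ≤-trans (WG-upper R l→r) (m≤n⊔m _ _)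

    R-step-bounded : ∀ {R} → NonDuplicating ar R →
      ∀ α {s t} → Step ar R s t → eval ar c α t + 0 ≤ eval ar c α s + WG ar c R
    R-step-bounded {R} nonDup = step-bound 0 (WG ar c R) rule-bound
      where
      rule-bound : ∀ {l r} → (l , r) ∈ R → ∀ α → eval ar c α r + 0 ≤ eval ar c α l + WG ar c R
      rule-bound {l} {r} l→r α = begin
        eval ar c α r + 0                                ≡⟨ +-identityʳ _ ⟩
        eval ar c α r                                    ≤⟨ nonDuplicating-gain α {l} {r} (nonDup l→r) ⟩
        eval ar c α l + (val0 ar c r ∸ val0 ar c l)      ≤⟨ +-monoʳ-≤ _ (WG-upper R l→r) ⟩
        eval ar c α l + WG ar c R                        ∎
        where open ≤-Reasoning

    mutual
      val0-bound : ∀ t → val0 ar c t ≤ MA c * size ar t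
      val0-bound (var x)    = z≤n
      val0-bound (fun f ts) = begin
        evals ar c (λ _ → 0) ts + c f  ≤⟨ +-mono-≤ (vals0-bound ts) (maxFin-upper c f) ⟩
        MA c * sizes ar ts + MA c      ≡⟨ +-comm _ (MA c) ⟩
        MA c + MA c * sizes ar ts      ≡⟨ sym (*-suc (MA c) (sizes ar ts)) ⟩
        MA c * suc (sizes ar ts)       ∎
        where open ≤-Reasoning

      vals0-bound : ∀ {n} (ts : Vec (Term ar) n) → evals ar c (λ _ → 0) ts ≤ MA c * sizes ar ts
      vals0-bound []       = z≤n
      vals0-bound (t ∷ ts) = ≤-trans (+-mono-≤ (val0-bound t) (vals0-bound ts))
        (≤-reflexive (sym (*-distribˡ-+ (MA c) (size ar t) (sizes ar ts))))

    derivation-budget : ∀ {R S} → Compatible ar c S → NonDuplicating ar R →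
      ∀ {n s u} → Iter ar (Step ar (R ++ S)) n s u →
      Σ ℕ λ m → (n ≤ suc (WG ar c R) * m + val0 ar c s) × RelDerivation R S m s
    derivation-budget compatible nonDup done = 0 , z≤n , _ , done
    derivation-budget {R} {S} compatible nonDup {s = s} (step {t = t} s→t rest)
      with derivation-budget compatible nonDup rest | split-step R S s→t
    ... | m , n≤ , (u , rel) | inj₁ R-step =
      suc m , R-step-budget (WG ar c R) m _ _ _ n≤ (R-step-bounded nonDup (λ _ → 0) R-step) ,
      u , step (s , t , ε , R-step , ε) rel
    ... | m , n≤ , rel | inj₂ S-step =
      m , S-step-budget (WG ar c R) m _ _ _ n≤ (S-step-decreases compatible (λ _ → 0) S-step) ,
      prepend-S-step S-step rel

-- The theorem: combine the counting argument with the maximality of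
-- dh(t, →R/S) and the bound [t] ≤ M_A · |t|.
mainTheorem11 : ∀ {k : ℕ} (ar : Fin k → ℕ) (R S : List (Rule ar)) (c : Fin k → ℕ) →
    IsTRS ar R → IsTRS ar S → Compatible ar c S → NonDuplicating ar R →
    ∀ (t : Term ar) → Terminating ar (Step ar (R ++ S)) t →
    ∀ (d e : ℕ) → IsDh ar (Step ar (R ++ S)) t d → IsDh ar (RelStep ar R S) t e →
    d ≤ (1 + WG ar c R) * e + MA c * size ar t
mainTheorem11 ar R S c _ _ compatible nonDup t _ d e ((_ , longest) , _) (_ , relMaximal)
  with derivation-budget ar c compatible nonDup longest
... | m , d≤ , (u , rel) = begin
  d                                        ≤⟨ d≤ ⟩
  (1 + WG ar c R) * m + val0 ar c t        ≤⟨ +-mono-≤ (*-monoʳ-≤ (1 + WG ar c R) (relMaximal m u rel))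
                                                         (val0-bound ar c t) ⟩
  (1 + WG ar c R) * e + MA c * size ar t   ∎
  where open ≤-Reasoning
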